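{- Let $F:\mathbb{F}_2^n\to\{0,1/2\}$ be a Boolean function and $d,k$ positive integers with $d\ge k$. (1) If there is a non-classical polynomial $P$ of degree $d$ and depth $k$ with $\Pr_x[F(x)=P(x)]=\gamma$, then there is $P'\in\mathcal{P}_{d,k}$ with $\Pr_x[F_k(x)=P'(x)]=\gamma$. (2) If there is $P\in\mathcal{P}_{d,k}$ with $\Pr_x[F_k(x)=P(x)]=\gamma$, then there is a non-classical polynomial $P'$ of degree $\le d+k-1$ and depth $k$ with $\Pr_x[F(x)=P'(x)]=\gamma$.
   Context: $\mathbb{T}=\mathbb{R}/\mathbb{Z}$; a Boolean function is identified with a map $\mathbb{F}_2^n\to\{0,1/2\}\subseteq\mathbb{T}$ (value $1$ corresponds to $1/2$). A non-classical polynomial of degree $\le d$ is $F:\mathbb{F}_2^n\to\mathbb{T}$ of the form $F(x)=\alpha+\sum \frac{c_{e_1,\dots,e_n,k}x_1^{e_1}\cdots x_n^{e_n}}{2^k}\bmod 1$, summing over $0\le e_i\le 1$, $k\ge1$ with $\sum_ie_i+(k-1)\le d$, where $\alpha\in\mathbb{T}$ is the shift and $c_{e,k}\in\{0,1\}$; its depth is the largest $k$ with some $c_{e,k}\neq0$. Only non-classical polynomials whose shift is $A/2^k$ with $k$ the depth and $A\in\{0,\dots,2^k-1\}$ are considered. The $k$-lift of a Boolean $F$ is $F_k:\{0,1\}^n\to\mathbb{Z}/2^k\mathbb{Z}$ with $F_k=0$ where $F=0$ and $F_k=2^{k-1}$ where $F=1$ (i.e. $F=1/2$). $\mathcal{P}_{d,k}$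 is the set of multilinear polynomials in $x_1,\dots,x_n$ of degree at most $d$ with coefficients in $\mathbb{Z}/2^k\mathbb{Z}$. Probabilities are over uniform $x\in\mathbb{F}_2^n$. -}

module Defs where

open import Data.Nat using (ℕ; zero; suc; _+_; _*_; _^_; _≤_; _<_)
open import Data.Nat.DivMod using (_%_)
open import Data.Nat.Properties using (m^n≢0; _≟_)
open import Data.Bool using (Bool; true; false; _∧_; _∨_; not; if_then_else_)
open import Data.Fin using (Fin; toℕ; fromℕ)
import Data.Fin as F
open import Data.List using (List; []; _∷_; map; _++_; foldr; length; filter; concatMap)
open import Data.Product using (_×_; _,_; ∃)
import Relation.Nullary
open import Relation.Binary.PropositionalEquality using (_≡_; _≢_)

-- Points of 𝔽₂ⁿ, as Boolean vectors (true = 1).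
Cube : ℕ → Set
Cube n = Fin n → Bool

allPoints : (n : ℕ) → List (Cube n)
allPoints zero = (λ ()) ∷ []
allPoints (suc n) =
  map (λ x → λ { F.zero → false ; (F.suc i) → x i }) (allPoints n) ++
  map (λ x → λ { F.zero → true ; (F.suc i) → x i }) (allPoints n)

-- Number of points satisfying a Boolean predicate; Pr_x[p x] = countPts n p / 2ⁿ.
countPts : (n : ℕ) → (Cube n → Bool) → ℕ
countPts n p = length (filter (λ x → Data.Bool._≟_ (p x) true) (allPoints n))

-- Monomial x^e = ∏_{i : e_i = 1} x_i, viewed as the integer 0/1.
mono : {n : ℕ} → Cube n → Cube n → Bool
mono {zero} e x = true
mono {suc n} e x = (not (e F.zero) ∨ x F.zero) ∧ mono (λ i → e (F.suc i)) (λ i → x (F.suc i))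

weight : {n : ℕ} → Cube n → ℕ
weight {zero} e = 0
weight {suc n} e = (if e F.zero then 1 else 0) + weight (λ i → e (F.suc i))

b2n : Bool → ℕ
b2n true = 1
b2n false = 0

_mod2^_ : ℕ → ℕ → ℕ
a mod2^ m = _%_ a (2 ^ m) ⦃ m^n≢0 2 m ⦄

-- Dyadic elements of 𝕋 = ℝ/ℤ : the pair (a , j) denotes a / 2^j mod 1.

𝕋₂ : Set
𝕋₂ = ℕ × ℕ

_+ₜ_ : 𝕋₂ → 𝕋₂ → 𝕋₂
(a , i) +ₜ (b , j) = (a * 2 ^ j + b * 2 ^ i , i + j)

0ₜ : 𝕋₂
0ₜ = (0 , 0)

eqₜ : 𝕋₂ → 𝕋₂ → Bool
eqₜ (a , i) (b , j) with (a * 2 ^ j) mod2^ (i + j) ≟ (b * 2 ^ i) mod2^ (i + j)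
... | Relation.Nullary.yes _ = true
... | Relation.Nullary.no _ = false

sumₜ : List 𝕋₂ → 𝕋₂
sumₜ = foldr _+ₜ_ 0ₜ

-- Boolean functions 𝔽₂ⁿ → {0, 1/2} ⊆ 𝕋 (true ↦ 1/2).

BoolFun : ℕ → Set
BoolFun n = Cube n → Bool

toT : Bool → 𝕋₂
toT b = (b2n b , 1)

-- Non-classical polynomials whose coefficients c_{e,j} vanish for j > k
-- and whose shift is A / 2^k.  The index j : Fin k stands for j+1 ∈ {1,…,k}.

record NCPoly (n k : ℕ) : Set where
  field
    shift : ℕ
    shift< : shift < 2 ^ k
    coeff : Cube n → Fin k → Bool
open NCPoly public

evalNC : {n k : ℕ} → NCPoly n k → Cube n → 𝕋₂
evalNC {n} {k} P x =
  (shift P , k) +ₜ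
  sumₜ (concatMap (λ e → map (λ j → (b2n (coeff P e j ∧ mono e x) , suc (toℕ j)))
                              (Data.List.allFin k))
                  (allPoints n))

-- degree ≤ d : every nonzero term c_{e,j} x^e/2^j has |e| + (j-1) ≤ d
NCDegree≤ : {n k : ℕ} → NCPoly n k → ℕ → Set
NCDegree≤ {n} {k} P d = ∀ (e : Cube n) (j : Fin k) → coeff P e j ≡ true → weight e + toℕ j ≤ d

-- depth exactly k (k = suc m): some c_{e,k} ≠ 0 (and none with larger index, by the type)
HasDepth : {n m : ℕ} → NCPoly n (suc m) → Set
HasDepth {n} {m} P = ∃ λ (e : Cube n) → coeff P e (fromℕ m) ≡ true

agreeNC : {n k : ℕ} → BoolFun n → NCPoly n k → ℕ
agreeNC {n} F P = countPts n (λ x → eqₜ (toT (F x)) (evalNC P x))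

-- 𝒫_{d,k}: multilinear polynomials over ℤ/2^kℤ of degree ≤ d.

record ZPoly (n k : ℕ) : Set where
  field
    zcoeff : Cube n → ℕ
    zcoeff< : ∀ e → zcoeff e < 2 ^ k
open ZPoly public

InPdk : {n k : ℕ} → ZPoly n k → ℕ → Set
InPdk {n} P d = ∀ (e : Cube n) → zcoeff P e ≢ 0 → weight e ≤ d

evalZ : {n k : ℕ} → ZPoly n k → Cube n → ℕ
evalZ {n} {k} P x = foldr _+_ 0 (map (λ e → zcoeff P e * b2n (mono e x)) (allPoints n)) mod2^ k

-- k-lift of F (k = suc m): 0 ↦ 0, 1 ↦ 2^(k-1)
liftK : {n : ℕ} → (m : ℕ) → BoolFun n → Cube n → ℕ
liftK m F x = if F x then 2 ^ m else 0

agreeZ : {n m : ℕ} → BoolFun n → ZPoly n (suc m) → ℕ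
agreeZ {n} {m} F P = countPts n (λ x → Data.Nat._≡ᵇ_ (liftK m F x mod2^ suc m) (evalZ P x))

module Submission where

-- Multiplying by 2^k maps the values of a depth-k polynomial, which lie in 2^-k ℤ / ℤ, bijectively
-- onto ℤ/2^k, sending 1/2 to 2^(k-1); so F(x) = P(x) exactly when F_k(x) = 2^k P(x).  Writing
-- P = A/2^k + Σ c_{e,j} x^e / 2^j gives 2^k P = A + Σ_e (Σ_j c_{e,j} 2^(k-j)) x^e, a polynomial
-- of degree ≤ d over ℤ/2^k.  Conversely, the binary digits of the coefficients of Q ∈ 𝒫_{d,k}
-- are the c_{e,j} of a non-classical polynomial whose degree exceeds d by at most k - 1.  For
-- depth exactly k the constant coefficient is first made odd by adding δ ∈ {0,1}, and the shift
-- -δ/2^k compensates.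

open import Defs
open import Data.Bool using (Bool; true; false; if_then_else_; _∧_; not)
import Data.Bool.Properties as Bool
open import Data.Empty using (⊥-elim)
open import Data.Fin using (Fin; toℕ; fromℕ)
import Data.Fin as Fin
import Data.Fin.Properties as Fin
open import Data.List using (List; []; _∷_; map; _++_; concatMap; allFin; length)
import Data.List.Properties as List
open import Data.List.Relation.Unary.All as All using (All; []; _∷_)
import Data.List.Relation.Unary.All.Properties as All
open import Data.Nat using (ℕ; zero; suc; _+_; _*_; _∸_; _^_; _≤_; _<_; z≤n; s≤s; NonZero; _≡ᵇ_)
open import Data.Nat.DivMod
open import Data.Nat.Divisibility using (divides)
open import Data.Nat.ListAction using (sum)
open import Data.Nat.ListAction.Properties using (sum-++)
open import Data.Nat.Properties
open import Algebra.Properties.CommutativeSemigroup +-commutativeSemigroup using (interchange)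
open import Data.Nat.Solver using (module +-*-Solver)
open import Data.Product using (_×_; _,_; proj₁; proj₂; Σ)
open import Function.Base using (_∘_)
open import Function.Bundles using (_⇔_; mk⇔)
open import Function.Properties.Equivalence using () renaming (sym to ⇔-sym; trans to ⇔-trans)
open import Function.Related.Propositional using (module EquationalReasoning)
open import Relation.Binary.PropositionalEquality
open import Relation.Nullary using (yes; no; contradiction)
open +-*-Solver

2^≢0 : ∀ N → NonZero (2 ^ N)
2^≢0 N = m^n≢0 2 N

infix 4 _≡_[mod2^_]
_≡_[mod2^_] : ℕ → ℕ → ℕ → Set
u ≡ v [mod2^ N ] = u mod2^ N ≡ v mod2^ N

0-mod2^ : ∀ N → 0 mod2^ N ≡ 0
0-mod2^ N = m<n⇒m%n≡m ⦃ 2^≢0 N ⦄ (m^n>0 2 N)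

mod2^-idem : ∀ N u → u mod2^ N ≡ u [mod2^ N ]
mod2^-idem N u = m%n%n≡m%n u (2 ^ N) ⦃ 2^≢0 N ⦄

*2^-mod2^ : ∀ N c u → (u * 2 ^ c) mod2^ (N + c) ≡ (u mod2^ N) * 2 ^ c
*2^-mod2^ N c u = begin
  (u * 2 ^ c) mod2^ (N + c)
    ≡⟨ %-congʳ ⦃ 2^≢0 (N + c) ⦄ ⦃ 2^N*2^c≢0 ⦄ (^-distribˡ-+-* 2 N c) ⟩
  _%_ (u * 2 ^ c) (2 ^ N * 2 ^ c) ⦃ 2^N*2^c≢0 ⦄
    ≡⟨ m%n*o≡m*o%[n*o] u (2 ^ N) (2 ^ c) ⦃ 2^≢0 N ⦄ ⦃ 2^N*2^c≢0 ⦄ ⟨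
  (u mod2^ N) * 2 ^ c
    ∎
  where
  open ≡-Reasoning
  2^N*2^c≢0 : NonZero (2 ^ N * 2 ^ c)
  2^N*2^c≢0 = m*n≢0 (2 ^ N) (2 ^ c) ⦃ 2^≢0 N ⦄ ⦃ 2^≢0 c ⦄

mod2^-*2^ : ∀ N c u v → (u ≡ v [mod2^ N ]) ⇔ (u * 2 ^ c ≡ v * 2 ^ c [mod2^ N + c ])
mod2^-*2^ N c u v = mk⇔
  (λ u≡v → trans (*2^-mod2^ N c u) (trans (cong (_* 2 ^ c) u≡v) (sym (*2^-mod2^ N c v))))
  (λ u2^c≡v2^c → *-cancelʳ-≡ _ _ (2 ^ c) ⦃ 2^≢0 c ⦄
     (trans (sym (*2^-mod2^ N c u)) (trans u2^c≡v2^c (*2^-mod2^ N c v))))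

mod2^-+ : ∀ N {u u′ v v′} → u ≡ u′ [mod2^ N ] → v ≡ v′ [mod2^ N ] → u + v ≡ u′ + v′ [mod2^ N ]
mod2^-+ N {u} {u′} {v} {v′} u≡u′ v≡v′ = begin
  (u + v) mod2^ N                        ≡⟨ %-distribˡ-+ u v (2 ^ N) ⦃ 2^≢0 N ⦄ ⟩
  (u mod2^ N + v mod2^ N) mod2^ N        ≡⟨ cong₂ (λ a b → (a + b) mod2^ N) u≡u′ v≡v′ ⟩
  (u′ mod2^ N + v′ mod2^ N) mod2^ N      ≡⟨ %-distribˡ-+ u′ v′ (2 ^ N) ⦃ 2^≢0 N ⦄ ⟨
  (u′ + v′) mod2^ N                      ∎
  where open ≡-Reasoning

mod2^-*ʳ : ∀ N w {u u′} → u ≡ u′ [mod2^ N ] → u * w ≡ u′ * w [mod2^ N ]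
mod2^-*ʳ N w {u} {u′} u≡u′ = begin
  (u * w) mod2^ N                        ≡⟨ %-distribˡ-* u w (2 ^ N) ⦃ 2^≢0 N ⦄ ⟩
  (u mod2^ N * w mod2^ N) mod2^ N        ≡⟨ cong (λ a → (a * w mod2^ N) mod2^ N) u≡u′ ⟩
  (u′ mod2^ N * w mod2^ N) mod2^ N       ≡⟨ %-distribˡ-* u′ w (2 ^ N) ⦃ 2^≢0 N ⦄ ⟨
  (u′ * w) mod2^ N                       ∎
  where open ≡-Reasoning

eqₜ≡true⇔ : ∀ a i b j → eqₜ (a , i) (b , j) ≡ true ⇔ (a * 2 ^ j ≡ b * 2 ^ i [mod2^ i + j ])
eqₜ≡true⇔ a i b j with (a * 2 ^ j) mod2^ (i + j) ≟ (b * 2 ^ i) mod2^ (i + j)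
... | yes eq = mk⇔ (λ _ → eq) (λ _ → refl)
... | no ¬eq = mk⇔ (λ ()) (λ eq → ⊥-elim (¬eq eq))

-- Scaled K (a , i) r : 2^K · a/2^i = r holds exactly, not merely modulo 1.
Scaled : ℕ → 𝕋₂ → ℕ → Set
Scaled K (a , i) r = a * 2 ^ K ≡ r * 2 ^ i

scaled-*2^ : ∀ K a i r j → Scaled K (a , i) r → a * 2 ^ j * 2 ^ K ≡ r * 2 ^ (i + j)
scaled-*2^ K a i r j a2^K≡r2^i = begin
  a * 2 ^ j * 2 ^ K     ≡⟨ solve 3 (λ a x y → a :* x :* y := a :* y :* x) refl a (2 ^ j) (2 ^ K) ⟩
  a * 2 ^ K * 2 ^ j     ≡⟨ cong (_* 2 ^ j) a2^K≡r2^i ⟩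
  r * 2 ^ i * 2 ^ j     ≡⟨ *-assoc r (2 ^ i) (2 ^ j) ⟩
  r * (2 ^ i * 2 ^ j)   ≡⟨ cong (r *_) (^-distribˡ-+-* 2 i j) ⟨
  r * 2 ^ (i + j)       ∎
  where open ≡-Reasoning

scaled-commonDenominator : ∀ K {a i b j r s} → Scaled K (a , i) r → Scaled K (b , j) s →
                           a * 2 ^ j * 2 ^ K ≡ r * 2 ^ (i + j) × b * 2 ^ i * 2 ^ K ≡ s * 2 ^ (i + j)
scaled-commonDenominator K {a} {i} {b} {j} {r} {s} a2^K≡r2^i b2^K≡s2^j =
  scaled-*2^ K a i r j a2^K≡r2^i ,
  trans (scaled-*2^ K b j s i b2^K≡s2^j) (cong (λ t → s * 2 ^ t) (+-comm j i))

eqₜ-scaled : ∀ K {p q r s} → Scaled K p r → Scaled K q s → eqₜ p q ≡ true ⇔ (r ≡ s [mod2^ K ])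
eqₜ-scaled K {a , i} {b , j} {r} {s} p≈r q≈s = begin
  eqₜ (a , i) (b , j) ≡ true
    ∼⟨ eqₜ≡true⇔ a i b j ⟩
  (a * 2 ^ j ≡ b * 2 ^ i [mod2^ i + j ])
    ∼⟨ mod2^-*2^ (i + j) K _ _ ⟩
  (a * 2 ^ j * 2 ^ K ≡ b * 2 ^ i * 2 ^ K [mod2^ i + j + K ])
    ≡⟨ cong₂ (λ t u → t ≡ u [mod2^ i + j + K ]) a′ b′ ⟩
  (r * 2 ^ (i + j) ≡ s * 2 ^ (i + j) [mod2^ i + j + K ])
    ≡⟨ cong (λ N → r * 2 ^ (i + j) ≡ s * 2 ^ (i + j) [mod2^ N ]) (+-comm (i + j) K) ⟩
  (r * 2 ^ (i + j) ≡ s * 2 ^ (i + j) [mod2^ K + (i + j) ])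
    ∼⟨ ⇔-sym (mod2^-*2^ K (i + j) r s) ⟩
  (r ≡ s [mod2^ K ])
    ∎
  where
  open EquationalReasoning
  common = scaled-commonDenominator K {a} {i} {b} {j} {r} {s} p≈r q≈s
  a′ = proj₁ common
  b′ = proj₂ common

scaled-+ₜ : ∀ K {p q r s} → Scaled K p r → Scaled K q s → Scaled K (p +ₜ q) (r + s)
scaled-+ₜ K {a , i} {b , j} {r} {s} p≈r q≈s = begin
  (a * 2 ^ j + b * 2 ^ i) * 2 ^ K         ≡⟨ *-distribʳ-+ (2 ^ K) (a * 2 ^ j) (b * 2 ^ i) ⟩
  a * 2 ^ j * 2 ^ K + b * 2 ^ i * 2 ^ K   ≡⟨ cong₂ _+_ a′ b′ ⟩
  r * 2 ^ (i + j) + s * 2 ^ (i + j)       ≡⟨ *-distribʳ-+ (2 ^ (i + j)) r s ⟨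
  (r + s) * 2 ^ (i + j)                   ∎
  where
  open ≡-Reasoning
  common = scaled-commonDenominator K {a} {i} {b} {j} {r} {s} p≈r q≈s
  a′ = proj₁ common
  b′ = proj₂ common

rescale : ℕ → 𝕋₂ → ℕ
rescale K (a , i) = a * 2 ^ (K ∸ i)

scaled-rescale : ∀ K a {i} → i ≤ K → Scaled K (a , i) (rescale K (a , i))
scaled-rescale K a {i} i≤K = begin
  a * 2 ^ K                 ≡⟨ cong (λ t → a * 2 ^ t) (m∸n+n≡m i≤K) ⟨
  a * 2 ^ (K ∸ i + i)       ≡⟨ cong (a *_) (^-distribˡ-+-* 2 (K ∸ i) i) ⟩
  a * (2 ^ (K ∸ i) * 2 ^ i) ≡⟨ *-assoc a _ _ ⟨
  a * 2 ^ (K ∸ i) * 2 ^ i   ∎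
  where open ≡-Reasoning

scaled-sumₜ : ∀ K {ps} → All (λ p → proj₂ p ≤ K) ps → Scaled K (sumₜ ps) (sum (map (rescale K) ps))
scaled-sumₜ K {[]} [] = refl
scaled-sumₜ K {(a , i) ∷ ps} (i≤K ∷ bounded) =
  scaled-+ₜ K {a , i} {sumₜ ps} {rescale K (a , i)} {sum (map (rescale K) ps)}
    (scaled-rescale K a i≤K) (scaled-sumₜ K bounded)

toT-scaled : ∀ m b → Scaled (suc m) (toT b) (if b then 2 ^ m else 0)
toT-scaled m false = refl
toT-scaled m true = solve 1 (λ x → con 1 :* (con 2 :* x) := x :* con 2) refl (2 ^ m)

module _ {A : Set} where

  sum-map-+ : ∀ (f g : A → ℕ) xs → sum (map (λ x → f x + g x) xs) ≡ sum (map f xs) + sum (map g xs)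
  sum-map-+ f g [] = refl
  sum-map-+ f g (x ∷ xs) = begin
    f x + g x + sum (map (λ x → f x + g x) xs)    ≡⟨ cong (f x + g x +_) (sum-map-+ f g xs) ⟩
    f x + g x + (sum (map f xs) + sum (map g xs)) ≡⟨ interchange (f x) (g x) _ _ ⟩
    f x + sum (map f xs) + (g x + sum (map g xs)) ∎
    where open ≡-Reasoning

  sum-map-*ʳ : ∀ (f : A → ℕ) c xs → sum (map (λ x → f x * c) xs) ≡ sum (map f xs) * c
  sum-map-*ʳ f c [] = refl
  sum-map-*ʳ f c (x ∷ xs) = trans (cong (f x * c +_) (sum-map-*ʳ f c xs)) (sym (*-distribʳ-+ c (f x) _))

  sum-map-0 : ∀ (xs : List A) → sum (map (λ _ → 0) xs) ≡ 0
  sum-map-0 [] = refl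
  sum-map-0 (_ ∷ xs) = sum-map-0 xs

  sum-map-cong : ∀ {f g : A → ℕ} → (∀ x → f x ≡ g x) → ∀ xs → sum (map f xs) ≡ sum (map g xs)
  sum-map-cong f≗g xs = cong sum (List.map-cong f≗g xs)

  sum-map-mod2^ : ∀ N {f g : A → ℕ} → (∀ x → f x ≡ g x [mod2^ N ]) → ∀ xs →
                  sum (map f xs) ≡ sum (map g xs) [mod2^ N ]
  sum-map-mod2^ N f≡g [] = refl
  sum-map-mod2^ N f≡g (x ∷ xs) = mod2^-+ N (f≡g x) (sum-map-mod2^ N f≡g xs)

  sum-map-concatMap : ∀ {B : Set} (g : B → ℕ) (f : A → List B) xs →
                      sum (map g (concatMap f xs)) ≡ sum (map (λ x → sum (map g (f x))) xs)
  sum-map-concatMap g f [] = refl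
  sum-map-concatMap g f (x ∷ xs) = begin
    sum (map g (f x ++ concatMap f xs))
      ≡⟨ cong sum (List.map-++ g (f x) _) ⟩
    sum (map g (f x) ++ map g (concatMap f xs))
      ≡⟨ sum-++ (map g (f x)) _ ⟩
    sum (map g (f x)) + sum (map g (concatMap f xs))
      ≡⟨ cong (sum (map g (f x)) +_) (sum-map-concatMap g f xs) ⟩
    sum (map g (f x)) + sum (map (λ x → sum (map g (f x))) xs)
      ∎
    where open ≡-Reasoning

evalℕ : ∀ {n} → (Cube n → ℕ) → Cube n → ℕ
evalℕ {n} a x = sum (map (λ e → a e * b2n (mono e x)) (allPoints n))

evalℕ-+ : ∀ {n} (a b : Cube n → ℕ) x → evalℕ (λ e → a e + b e) x ≡ evalℕ a x + evalℕ b x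
evalℕ-+ {n} a b x = trans (sum-map-cong (λ e → *-distribʳ-+ (b2n (mono e x)) (a e) (b e)) (allPoints n))
                          (sum-map-+ _ _ (allPoints n))

evalℕ-mod2^ : ∀ N {n} {a b : Cube n → ℕ} → (∀ e → a e ≡ b e [mod2^ N ]) → ∀ x →
              evalℕ a x ≡ evalℕ b x [mod2^ N ]
evalℕ-mod2^ N {n} a≡b x = sum-map-mod2^ N (λ e → mod2^-*ʳ N (b2n (mono e x)) (a≡b e)) (allPoints n)

isZero : ∀ {n} → Cube n → Bool
isZero {zero} e = true
isZero {suc n} e = not (e Fin.zero) ∧ isZero (λ i → e (Fin.suc i))

isZero-weight : ∀ {n} (e : Cube n) → isZero e ≡ true → weight e ≡ 0
isZero-weight {zero} e _ = refl
isZero-weight {suc n} e isZero-e with e Fin.zero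
... | false = isZero-weight (λ i → e (Fin.suc i)) isZero-e

constantPoly : ∀ {n} → ℕ → Cube n → ℕ
constantPoly A e = if isZero e then A else 0

evalℕ-constantPoly : ∀ n A (x : Cube n) → evalℕ (constantPoly A) x ≡ A
evalℕ-constantPoly zero A x = trans (+-identityʳ (A * 1)) (*-identityʳ A)
evalℕ-constantPoly (suc n) A x = begin
  evalℕ (constantPoly A) x
    ≡⟨ cong sum (List.map-++ _ (map _ points) _) ⟩
  sum (map _ (map _ points) ++ map _ (map _ points))
    ≡⟨ sum-++ (map _ (map _ points)) _ ⟩
  sum (map _ (map _ points)) + sum (map _ (map _ points))
    ≡⟨ cong₂ _+_ (cong sum (List.map-∘ points)) (cong sum (List.map-∘ points)) ⟨
  evalℕ (constantPoly A) (x ∘ Fin.suc) + sum (map (λ _ → 0) points)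
    ≡⟨ cong₂ _+_ (evalℕ-constantPoly n A (x ∘ Fin.suc)) (sum-map-0 points) ⟩
  A + 0
    ≡⟨ +-identityʳ A ⟩
  A ∎
  where
  open ≡-Reasoning
  points = allPoints n

fromDigits : (m : ℕ) → (Fin (suc m) → Bool) → ℕ
fromDigits m c = sum (map (λ j → b2n (c j) * 2 ^ (m ∸ toℕ j)) (allFin (suc m)))

bit : ℕ → ℕ → Bool
bit i a = (_/_ a (2 ^ i) ⦃ 2^≢0 i ⦄) % 2 ≡ᵇ 1

-- digits m a j is the digit of a of weight 2^(m - j): after scaling by 2^(m+1) this is the
-- weight of the coefficient c_{e, j+1} of a non-classical polynomial.
digits : (m : ℕ) → ℕ → Fin (suc m) → Bool
digits m a j = bit (m ∸ toℕ j) a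

b2n-≡ᵇ1 : ∀ r → r < 2 → b2n (r ≡ᵇ 1) ≡ r
b2n-≡ᵇ1 0 _ = refl
b2n-≡ᵇ1 1 _ = refl
b2n-≡ᵇ1 (suc (suc r)) (s≤s (s≤s ()))

mod2^-suc : ∀ i a → a mod2^ suc i ≡ b2n (bit i a) * 2 ^ i + a mod2^ i
mod2^-suc i a = begin
  t                                     ≡⟨ m≡m%n+[m/n]*n t (2 ^ i) ⦃ 2^≢0 i ⦄ ⟩
  t mod2^ i + t /2^i * 2 ^ i            ≡⟨ +-comm (t mod2^ i) _ ⟩
  t /2^i * 2 ^ i + t mod2^ i            ≡⟨ cong₂ (λ q r → q * 2 ^ i + r) t/2^i≡bit t%2^i≡a%2^i ⟩
  b2n (bit i a) * 2 ^ i + a mod2^ i     ∎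
  where
  open ≡-Reasoning
  _/2^i : ℕ → ℕ
  u /2^i = _/_ u (2 ^ i) ⦃ 2^≢0 i ⦄
  t = a mod2^ suc i
  t%2^i≡a%2^i : t mod2^ i ≡ a mod2^ i
  t%2^i≡a%2^i = m∣n⇒o%n%m≡o%m (2 ^ i) (2 ^ suc i) a ⦃ 2^≢0 i ⦄ ⦃ 2^≢0 (suc i) ⦄ (divides 2 refl)
  t/2^i≡bit : t /2^i ≡ b2n (bit i a)
  t/2^i≡bit = trans (m%[n*o]/o≡m/o%n a 2 (2 ^ i) ⦃ _ ⦄ ⦃ 2^≢0 i ⦄ ⦃ 2^≢0 (suc i) ⦄)
                    (sym (b2n-≡ᵇ1 _ (m%n<n (a /2^i) 2)))

fromDigits-suc : ∀ m (c : Fin (suc (suc m)) → Bool) →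
                 fromDigits (suc m) c ≡ b2n (c Fin.zero) * 2 ^ suc m + fromDigits m (c ∘ Fin.suc)
fromDigits-suc m c = cong (b2n (c Fin.zero) * 2 ^ suc m +_)
  (cong sum (trans (List.map-tabulate Fin.suc (λ j → b2n (c j) * 2 ^ (suc m ∸ toℕ j)))
                   (sym (List.map-tabulate (λ j → j) (λ j → b2n (c (Fin.suc j)) * 2 ^ (m ∸ toℕ j))))))

fromDigits-digits : ∀ m a → fromDigits m (digits m a) ≡ a mod2^ suc m
fromDigits-digits zero a = begin
  b2n (bit 0 a) * 1 + 0            ≡⟨ cong (b2n (bit 0 a) * 1 +_) (n%1≡0 a) ⟨
  b2n (bit 0 a) * 2 ^ 0 + a mod2^ 0 ≡⟨ mod2^-suc 0 a ⟨
  a mod2^ 1                         ∎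
  where open ≡-Reasoning
fromDigits-digits (suc m) a = begin
  fromDigits (suc m) (digits (suc m) a)
    ≡⟨ fromDigits-suc m (digits (suc m) a) ⟩
  b2n (bit (suc m) a) * 2 ^ suc m + fromDigits m (digits m a)
    ≡⟨ cong (b2n (bit (suc m) a) * 2 ^ suc m +_) (fromDigits-digits m a) ⟩
  b2n (bit (suc m) a) * 2 ^ suc m + a mod2^ suc m
    ≡⟨ mod2^-suc (suc m) a ⟨
  a mod2^ suc (suc m)
    ∎
  where open ≡-Reasoning

digits-last : ∀ m a → digits m a (fromℕ m) ≡ (a % 2 ≡ᵇ 1)
digits-last m a rewrite Fin.toℕ-fromℕ m | n∸n≡0 m | n/1≡n a = refl

digits-0 : ∀ m j → digits m 0 j ≡ false
digits-0 m j rewrite 0/n≡0 (2 ^ (m ∸ toℕ j)) ⦃ 2^≢0 (m ∸ toℕ j) ⦄ = refl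

fromDigits-false : ∀ m {c : Fin (suc m) → Bool} → (∀ j → c j ≡ false) → fromDigits m c ≡ 0
fromDigits-false m c≡false =
  trans (sum-map-cong (λ j → cong (λ b → b2n b * 2 ^ (m ∸ toℕ j)) (c≡false j)) (allFin (suc m)))
        (sum-map-0 (allFin (suc m)))

ncCoeffs : ∀ {n m} → NCPoly n (suc m) → Cube n → ℕ
ncCoeffs {m = m} P e = constantPoly (shift P) e + fromDigits m (coeff P e)

monomialTerms : ∀ {n m} → NCPoly n (suc m) → Cube n → Cube n → List 𝕋₂
monomialTerms {m = m} P x e = map (λ j → (b2n (coeff P e j ∧ mono e x) , suc (toℕ j))) (allFin (suc m))

ncTerms : ∀ {n m} → NCPoly n (suc m) → Cube n → List 𝕋₂
ncTerms {n} P x = concatMap (monomialTerms P x) (allPoints n)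

ncTerms-bounded : ∀ {n m} (P : NCPoly n (suc m)) x → All (λ p → proj₂ p ≤ suc m) (ncTerms P x)
ncTerms-bounded {n} P x =
  All.concat⁺ (All.map⁺ (All.universal (λ e → All.map⁺ (All.tabulate⁺ Fin.toℕ<n)) (allPoints n)))

b2n-∧ : ∀ b c → b2n (b ∧ c) ≡ b2n b * b2n c
b2n-∧ false c = refl
b2n-∧ true c = sym (+-identityʳ (b2n c))

sum-rescale-ncTerms : ∀ {n m} (P : NCPoly n (suc m)) x →
  sum (map (rescale (suc m)) (ncTerms P x)) ≡ evalℕ (λ e → fromDigits m (coeff P e)) x
sum-rescale-ncTerms {n} {m} P x =
  trans (sum-map-concatMap (rescale (suc m)) _ (allPoints n)) (sum-map-cong monomial (allPoints n))
  where
  monomial : ∀ e → sum (map (rescale (suc m)) (monomialTerms P x e)) ≡ fromDigits m (coeff P e) * b2n (mono e x)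
  monomial e = begin
    sum (map (rescale (suc m)) (map _ js))
      ≡⟨ cong sum (List.map-∘ js) ⟨
    sum (map (λ j → b2n (coeff P e j ∧ mono e x) * 2 ^ (m ∸ toℕ j)) js)
      ≡⟨ sum-map-cong digit∧mono js ⟩
    sum (map (λ j → b2n (coeff P e j) * 2 ^ (m ∸ toℕ j) * b2n (mono e x)) js)
      ≡⟨ sum-map-*ʳ (λ j → b2n (coeff P e j) * 2 ^ (m ∸ toℕ j)) (b2n (mono e x)) js ⟩
    fromDigits m (coeff P e) * b2n (mono e x)
      ∎
    where
    open ≡-Reasoning
    js = allFin (suc m)
    digit∧mono : ∀ j → b2n (coeff P e j ∧ mono e x) * 2 ^ (m ∸ toℕ j)
                       ≡ b2n (coeff P e j) * 2 ^ (m ∸ toℕ j) * b2n (mono e x)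
    digit∧mono j = begin
      b2n (coeff P e j ∧ mono e x) * 2 ^ (m ∸ toℕ j)
        ≡⟨ cong (_* 2 ^ (m ∸ toℕ j)) (b2n-∧ (coeff P e j) (mono e x)) ⟩
      b2n (coeff P e j) * b2n (mono e x) * 2 ^ (m ∸ toℕ j)
        ≡⟨ solve 3 (λ c y w → c :* y :* w := c :* w :* y) refl (b2n (coeff P e j)) (b2n (mono e x)) _ ⟩
      b2n (coeff P e j) * 2 ^ (m ∸ toℕ j) * b2n (mono e x)
        ∎

evalNC-scaled : ∀ {n m} (P : NCPoly n (suc m)) x → Scaled (suc m) (evalNC P x) (evalℕ (ncCoeffs P) x)
evalNC-scaled {n} {m} P x =
  subst (Scaled (suc m) (evalNC P x)) numerator
    (scaled-+ₜ (suc m) {shift P , suc m} {sumₜ (ncTerms P x)} {shift P} {sum (map (rescale (suc m)) (ncTerms P x))}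
               refl (scaled-sumₜ (suc m) (ncTerms-bounded P x)))
  where
  numerator : shift P + sum (map (rescale (suc m)) (ncTerms P x)) ≡ evalℕ (ncCoeffs P) x
  numerator = begin
    shift P + sum (map (rescale (suc m)) (ncTerms P x))
      ≡⟨ cong₂ _+_ (sym (evalℕ-constantPoly n (shift P) x)) (sum-rescale-ncTerms P x) ⟩
    evalℕ (constantPoly (shift P)) x + evalℕ (λ e → fromDigits m (coeff P e)) x
      ≡⟨ evalℕ-+ (constantPoly (shift P)) _ x ⟨
    evalℕ (ncCoeffs P) x ∎
    where open ≡-Reasoning

countPts-cong : ∀ n {p q : Cube n → Bool} → (∀ x → p x ≡ q x) → countPts n p ≡ countPts n q
countPts-cong n {p} {q} p≗q =
  cong length (List.filter-≐ (λ x → p x Bool.≟ true) (λ x → q x Bool.≟ true)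
    ((λ {x} px → trans (sym (p≗q x)) px) , (λ {x} qx → trans (p≗q x) qx)) (allPoints n))

≡ᵇ≡true⇔ : ∀ a b → (a ≡ᵇ b) ≡ true ⇔ a ≡ b
≡ᵇ≡true⇔ a b = ⇔-trans (⇔-sym Bool.T-≡) (mk⇔ (≡ᵇ⇒≡ a b) (≡⇒≡ᵇ a b))

agreeNC≡agreeZ : ∀ {n m} (F : BoolFun n) (P : NCPoly n (suc m)) (Z : ZPoly n (suc m)) →
                 (∀ e → ncCoeffs P e ≡ zcoeff Z e [mod2^ suc m ]) → agreeNC F P ≡ agreeZ F Z
agreeNC≡agreeZ {n} {m} F P Z coeffs≡ = countPts-cong n (λ x → Bool.⇔→≡ (agree-at x))
  where
  open EquationalReasoning
  agree-at : ∀ x → eqₜ (toT (F x)) (evalNC P x) ≡ true ⇔ ((liftK m F x mod2^ suc m ≡ᵇ evalZ Z x) ≡ true)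
  agree-at x = begin
    eqₜ (toT (F x)) (evalNC P x) ≡ true
      ∼⟨ eqₜ-scaled (suc m) {toT (F x)} {evalNC P x} (toT-scaled m (F x)) (evalNC-scaled P x) ⟩
    (liftK m F x ≡ evalℕ (ncCoeffs P) x [mod2^ suc m ])
      ∼⟨ mk⇔ (λ eq → trans eq evals≡) (λ eq → trans eq (sym evals≡)) ⟩
    (liftK m F x ≡ evalℕ (zcoeff Z) x [mod2^ suc m ])
      ∼⟨ ⇔-sym (≡ᵇ≡true⇔ _ _) ⟩
    (liftK m F x mod2^ suc m ≡ᵇ evalZ Z x) ≡ true
      ∎
    where
    evals≡ : evalℕ (ncCoeffs P) x ≡ evalℕ (zcoeff Z) x [mod2^ suc m ]
    evals≡ = evalℕ-mod2^ (suc m) coeffs≡ x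

ncCoeffs-aboveDegree : ∀ {n m d} (P : NCPoly n (suc m)) → NCDegree≤ P d →
                       ∀ e → d < weight e → ncCoeffs P e ≡ 0
ncCoeffs-aboveDegree {m = m} {d} P deg e d<weight = cong₂ _+_ constant≡0 (fromDigits-false m digit≡false)
  where
  constant≡0 : constantPoly (shift P) e ≡ 0
  constant≡0 with isZero e in isZero-e
  ... | true = ⊥-elim (<⇒≱ d<weight (subst (_≤ d) (sym (isZero-weight e isZero-e)) z≤n))
  ... | false = refl
  digit≡false : ∀ j → coeff P e j ≡ false
  digit≡false j with coeff P e j in c≡true
  ... | true = ⊥-elim (<⇒≱ d<weight (m+n≤o⇒m≤o (weight e) (deg e j c≡true)))
  ... | false = refl

toZPoly : ∀ {n m} → NCPoly n (suc m) → ZPoly n (suc m)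
toZPoly {m = m} P = record
  { zcoeff = λ e → ncCoeffs P e mod2^ suc m
  ; zcoeff< = λ e → m%n<n (ncCoeffs P e) (2 ^ suc m) ⦃ 2^≢0 (suc m) ⦄
  }

toZPoly-InPdk : ∀ {n m d} (P : NCPoly n (suc m)) → NCDegree≤ P d → InPdk (toZPoly P) d
toZPoly-InPdk {m = m} {d} P deg e coeff≢0 with weight e ≤? d
... | yes weight≤d = weight≤d
... | no weight≰d = ⊥-elim (coeff≢0 (begin
  ncCoeffs P e mod2^ suc m   ≡⟨ cong (_mod2^ suc m) (ncCoeffs-aboveDegree P deg e (≰⇒> weight≰d)) ⟩
  0 mod2^ suc m              ≡⟨ 0-mod2^ (suc m) ⟩
  0                          ∎))
  where open ≡-Reasoning

agreeNC≡agreeZ-toZPoly : ∀ {n m} (F : BoolFun n) (P : NCPoly n (suc m)) → agreeNC F P ≡ agreeZ F (toZPoly P)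
agreeNC≡agreeZ-toZPoly {m = m} F P =
  agreeNC≡agreeZ F P (toZPoly P) (λ e → sym (mod2^-idem (suc m) (ncCoeffs P e)))

0̂ : ∀ {n} → Cube n
0̂ _ = false

isZero-0̂ : ∀ n → isZero (0̂ {n}) ≡ true
isZero-0̂ zero = refl
isZero-0̂ (suc n) = isZero-0̂ n

parityFix : ℕ → ℕ
parityFix a = 1 ∸ a % 2

parityFix-odd : ∀ a → (a + parityFix a) % 2 ≡ 1
parityFix-odd a = trans (%-distribˡ-+ a (parityFix a) 2) (odd (a % 2) (m%n<n a 2))
  where
  odd : ∀ r → r < 2 → (r + (1 ∸ r) % 2) % 2 ≡ 1
  odd 0 _ = refl
  odd 1 _ = refl
  odd (suc (suc r)) (s≤s (s≤s ()))

negate-mod2^ : ∀ N δ → δ ≤ 2 ^ N → (2 ^ N ∸ δ) mod2^ N + δ ≡ 0 [mod2^ N ]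
negate-mod2^ N δ δ≤2^N = begin
  ((2 ^ N ∸ δ) mod2^ N + δ) mod2^ N   ≡⟨ mod2^-+ N (mod2^-idem N (2 ^ N ∸ δ)) refl ⟩
  (2 ^ N ∸ δ + δ) mod2^ N             ≡⟨ cong (_mod2^ N) (m∸n+n≡m δ≤2^N) ⟩
  (2 ^ N) mod2^ N                     ≡⟨ n%n≡0 (2 ^ N) ⦃ 2^≢0 N ⦄ ⟩
  0                                   ≡⟨ 0-mod2^ N ⟨
  0 mod2^ N                           ∎
  where open ≡-Reasoning

constantPoly-cancel : ∀ N {n s δ} → s + δ ≡ 0 [mod2^ N ] → ∀ (e : Cube n) a →
                      constantPoly s e + (a + constantPoly δ e) ≡ a [mod2^ N ]
constantPoly-cancel N {s = s} {δ} s+δ≡0 e a with isZero e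
... | true = begin
  (s + (a + δ)) mod2^ N   ≡⟨ cong (_mod2^ N) (solve 3 (λ s a δ → s :+ (a :+ δ) := (s :+ δ) :+ a) refl s a δ) ⟩
  (s + δ + a) mod2^ N     ≡⟨ mod2^-+ N s+δ≡0 refl ⟩
  (0 + a) mod2^ N         ∎
  where open ≡-Reasoning
... | false = cong (_mod2^ N) (+-identityʳ a)

module _ {n m : ℕ} (Z : ZPoly n (suc m)) where

  private
    δ : ℕ
    δ = parityFix (zcoeff Z 0̂)

  oddConstCoeffs : Cube n → ℕ
  oddConstCoeffs e = zcoeff Z e + constantPoly δ e

  toNCPoly : NCPoly n (suc m)
  toNCPoly = record
    { shift = (2 ^ suc m ∸ δ) mod2^ suc m
    ; shift< = m%n<n (2 ^ suc m ∸ δ) (2 ^ suc m) ⦃ 2^≢0 (suc m) ⦄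
    ; coeff = λ e → digits m (oddConstCoeffs e)
    }

  toNCPoly-HasDepth : HasDepth toNCPoly
  toNCPoly-HasDepth = 0̂ , (begin
    digits m (oddConstCoeffs 0̂) (fromℕ m)
      ≡⟨ digits-last m (oddConstCoeffs 0̂) ⟩
    oddConstCoeffs 0̂ % 2 ≡ᵇ 1
      ≡⟨ cong (λ b → (zcoeff Z 0̂ + (if b then δ else 0)) % 2 ≡ᵇ 1) (isZero-0̂ n) ⟩
    (zcoeff Z 0̂ + δ) % 2 ≡ᵇ 1
      ≡⟨ cong (_≡ᵇ 1) (parityFix-odd (zcoeff Z 0̂)) ⟩
    true
      ∎)
    where open ≡-Reasoning

  toNCPoly-degree : ∀ {d} → InPdk Z d → NCDegree≤ toNCPoly (d + m)
  toNCPoly-degree {d} deg e j digit≡true = +-mono-≤ weight≤d (Fin.toℕ≤pred[n] j)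
    where
    weight≤d : weight e ≤ d
    weight≤d with isZero e in isZero-e | zcoeff Z e ≟ 0
    ... | true  | _        = subst (_≤ d) (sym (isZero-weight e isZero-e)) z≤n
    ... | false | no a≢0  = deg e a≢0
    ... | false | yes a≡0 = contradiction (trans (sym digit≡true) digit≡false) λ ()
      where
      digit≡false : digits m (zcoeff Z e + 0) j ≡ false
      digit≡false = trans (cong (λ t → digits m (t + 0) j) a≡0) (digits-0 m j)

  ncCoeffs-toNCPoly : ∀ e → ncCoeffs toNCPoly e ≡ zcoeff Z e [mod2^ suc m ]
  ncCoeffs-toNCPoly e = begin
    (s + fromDigits m (digits m (oddConstCoeffs e))) mod2^ suc m
      ≡⟨ cong (λ t → (s + t) mod2^ suc m) (fromDigits-digits m _) ⟩
    (s + oddConstCoeffs e mod2^ suc m) mod2^ suc m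
      ≡⟨ mod2^-+ (suc m) {s} refl (mod2^-idem (suc m) _) ⟩
    (s + oddConstCoeffs e) mod2^ suc m
      ≡⟨ constantPoly-cancel (suc m) s+δ≡0 e (zcoeff Z e) ⟩
    zcoeff Z e mod2^ suc m
      ∎
    where
    open ≡-Reasoning
    s = constantPoly (shift toNCPoly) e
    s+δ≡0 : shift toNCPoly + δ ≡ 0 [mod2^ suc m ]
    s+δ≡0 = negate-mod2^ (suc m) δ (≤-trans (m∸n≤m 1 (zcoeff Z 0̂ % 2)) (m^n>0 2 (suc m)))

  agreeNC≡agreeZ-toNCPoly : ∀ (F : BoolFun n) → agreeNC F toNCPoly ≡ agreeZ F Z
  agreeNC≡agreeZ-toNCPoly F = agreeNC≡agreeZ F toNCPoly Z ncCoeffs-toNCPoly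

lemma5p3 : (n : ℕ) (F : BoolFun n) (d m : ℕ) → suc m ≤ d → (γ : ℕ) →
    ((Σ (NCPoly n (suc m)) λ P → NCDegree≤ P d × HasDepth P × agreeNC F P ≡ γ) →
       Σ (ZPoly n (suc m)) λ P′ → InPdk P′ d × agreeZ F P′ ≡ γ)
    × ((Σ (ZPoly n (suc m)) λ P → InPdk P d × agreeZ F P ≡ γ) →
       Σ (NCPoly n (suc m)) λ P′ → NCDegree≤ P′ (d + m) × HasDepth P′ × agreeNC F P′ ≡ γ)
lemma5p3 n F d m _ γ =
  (λ (P , deg , _ , agree≡γ) →
     toZPoly P , toZPoly-InPdk P deg , trans (sym (agreeNC≡agreeZ-toZPoly F P)) agree≡γ) ,
  (λ (Z , deg , agree≡γ) →
     toNCPoly Z , toNCPoly-degree Z deg , toNCPoly-HasDepth Z , trans (agreeNC≡agreeZ-toNCPoly Z F) agree≡γ)
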